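{- Let $q \ge 2$ be an integer and let $a_2, \dots, a_q$ be integers with $a_i \ge 1$ for $2 \le i \le q$ and $a_q \ge 2$. Consider the power series $$T(X) = 2 - \frac{1}{1-X} - \sum_{i=2}^{q} (a_i - 1) X^{i-1}.$$ For a positive integer $r$ put $k = k(r) = 1 + rq$ and $c = c(r) = 2 + (r-1)q$. Let $p_k(X)$ be the degree-$k$ Taylor polynomial of $T(X)$, i.e. $$p_k(X) = 2 - \frac{X^{k+1}-1}{X-1} - \sum_{i=2}^{q} (a_i-1)X^{i-1} = \sum_{j=0}^{k} c_j X^j \quad (\text{note } c_k=-1).$$ Let $\{G_n\}_{n\ge1}$ be the sequence with $G_1 = 1$, $G_i = 0$ for $2 \le i \le k$, and $G_n = \sum_{j=0}^{k-1} c_j G_{n-k+j}$ for $n > k$. Explicitly, this recursion is $$G_n = G_{n-k} - \left(a_2 G_{n-k+1} + \cdots + a_q G_{n-k+q-1}\right) - \left(G_{n-k+q} + \cdots + G_{n-1}\right).$$ For integers $i, j$ with $k + (i-1)c + j \ge 1$ set $R_{i,j} = G_{k+(i-1)c+j}$. Thus $R_{t,s}$ for $1\le t\le r$, $1\le s\le c$ is the $r\times c$ rectangle formed by $G_{k+1},\dots,G_{k+rc}$ written row by row. This convention gives $R_{0,u} = 0$ for $1 \le u \le c$ and $R_{t,1-s} = R_{t-1,c+1-s}$. Define $l(t) = 2 + (t-1)q$. Then: (i) $R_{1,1} = 1$, $R_{1,2} = -1$, and $R_{1,u} = 0$ for $3 \le u \le c$. (ii) For $2 \le i \le r$ and $1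 \le j \le c$, the entries $R_{i,j}$ satisfy the recursion defining $G$ and also the triangle recursion $$R_{i,j} = -(a_q - 1) R_{i-1,j} - \sum_{e=2}^{q-1} (a_e - a_{e+1}) R_{i-1,\,j-q+e} + (1 + a_2) R_{i-1,\,j-q+1} - R_{i-1,\,j-q}.$$ (iii) $R_{t,1} \neq 0$ for $1 \le t \le r$. (iv) For $1 \le t \le r$, $R_{t,l(t)} \neq 0$ and $R_{t,u} = 0$ for all $l(t) < u \le c$. In particular $l(t)$ is the column position of the last nonzero entry in row $t$. (v) The family of these sequences (over all $r \ge 1$) has a triangle embedded in it. That is, for each $r$ the sequence $l(1), \dots, l(r)$ is strictly increasing. Moreover, any two members are compatible: for orders $k(r_1)$ and $k(r_2)$ with rectangles $R^{(r_1)}$ and $R^{(r_2)}$, the last-nonzero positions agree, and $R^{(r_1)}_{t,s} = R^{(r_2)}_{t,s}$ for $1 \le s \le l(t)$ and $1 \le t \le \min(r_1, r_2)$.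
   Context: Convention: a polynomial $p(X)=\sum_{j=0}^k c_jX^j$ with leading coefficient $c_k=-1$ is regarded as the characteristic polynomial of the order-$k$ recursion $G_n=\sum_{j=0}^{k-1}c_jG_{n-k+j}$. The family of recursive sequences associated with a Taylor series consists of, for each order $k$, the sequence satisfying the recursion attached to the degree-$k$ Taylor polynomial, with initial values $G_1=1$ and $G_i=0$ for $2\le i\le k$. The sequence of order $k(r)$ has a triangle embedded in it if, in its $r\times c(r)$ rectangle, the last nonzero position $l(t)$ of each row $t$ (nonzero at $l(t)$, zero afterwards) exists and $l(1)<\dots<l(r)$. -}

module Defs where

open import Data.Nat as ℕ using (ℕ; zero; suc; _∸_; _≤_; _<_)
open import Data.Integer as ℤ using (ℤ; +_; _+_; _-_; _*_; -_; ∣_∣)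
open import Data.List using (List; []; _∷_; _++_; [_]; replicate; drop)
open import Data.Bool using (if_then_else_)
open import Data.Product using (Σ; _×_)
open import Relation.Binary.PropositionalEquality using (_≡_; _≢_)

sumRange : ℕ → ℕ → (ℕ → ℤ) → ℤ
sumRange lo zero    f = + 0
sumRange lo (suc n) f = f lo + sumRange (suc lo) n f

-- Formal power series over ℤ, as coefficient sequences (coefficient of X^j)

PowerSeries : Set
PowerSeries = ℕ → ℤ

_⊖ₛ_ : PowerSeries → PowerSeries → PowerSeries
(f ⊖ₛ g) j = f j - g j

constTwo : PowerSeries
constTwo zero    = + 2
constTwo (suc _) = + 0

geometric : PowerSeries
geometric _ = + 1

monomial : ℕ → PowerSeries
monomial m j = if m ℕ.≡ᵇ j then + 1 else + 0

Tseries : ℕ → (ℕ → ℤ) → PowerSeries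
Tseries q a =
  (constTwo ⊖ₛ geometric) ⊖ₛ
  (λ j → sumRange 2 (q ∸ 1) (λ i → (a i - + 1) * monomial (i ∸ 1) j))

taylorCoeffs : PowerSeries → ℕ → ℕ → ℤ
taylorCoeffs s k j = if j ℕ.≤ᵇ k then s j else + 0

-- The order-k recursion  G_n = Σ_{j=0}^{k-1} c_j G_{n-k+j}  (n > k),
-- with G_1 = 1, G_i = 0 for 2 ≤ i ≤ k.  Computed via a sliding window:
-- window c k m = [G_{m+1}, ..., G_{m+k}].

initWindow : ℕ → List ℤ
initWindow zero    = []
initWindow (suc k) = + 1 ∷ replicate k (+ 0)

dot : (ℕ → ℤ) → ℕ → List ℤ → ℤ
dot c i []       = + 0
dot c i (w ∷ ws) = c i * w + dot c (suc i) ws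

stepWindow : (ℕ → ℤ) → List ℤ → List ℤ
stepWindow c w = drop 1 w ++ [ dot c 0 w ]

window : (ℕ → ℤ) → ℕ → ℕ → List ℤ
window c k zero    = initWindow k
window c k (suc m) = stepWindow c (window c k m)

headOr0 : List ℤ → ℤ
headOr0 []      = + 0
headOr0 (x ∷ _) = x

-- recSeq c k n = G_n  (n ≥ 1; the value at n = 0 is an unused dummy 0)
recSeq : (ℕ → ℤ) → ℕ → ℕ → ℤ
recSeq c k zero    = + 0
recSeq c k (suc m) = headOr0 (window c k m)

familySeq : PowerSeries → ℕ → ℕ → ℤ
familySeq s k = recSeq (taylorCoeffs s k) k

kOf : ℕ → ℕ → ℕ
kOf q r = 1 ℕ.+ r ℕ.* q

cOf : ℕ → ℕ → ℕ
cOf q r = 2 ℕ.+ (r ∸ 1) ℕ.* q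

lOf : ℕ → ℕ → ℕ
lOf q t = 2 ℕ.+ (t ∸ 1) ℕ.* q

Gseq : ℕ → (ℕ → ℤ) → ℕ → ℕ → ℤ
Gseq q a r = familySeq (Tseries q a) (kOf q r)

-- R_{i,j} = G_{k + (i-1)c + j}  (integer indices; only used when the index is ≥ 1)
Rz : ℕ → (ℕ → ℤ) → ℕ → ℤ → ℤ → ℤ
Rz q a r i j = Gseq q a r ∣ + kOf q r + (i - + 1) * + cOf q r + j ∣

Rn : ℕ → (ℕ → ℤ) → ℕ → ℕ → ℕ → ℤ
Rn q a r t s = Rz q a r (+ t) (+ s)

LastNonzero : (ℕ → ℕ → ℤ) → ℕ → ℕ → ℕ → Set
LastNonzero R c t p =
  (1 ≤ p) × (p ≤ c) × (R t p ≢ + 0) × (∀ u → p < u → u ≤ c → R t u ≡ + 0)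

TriangleEmbedded : (ℕ → ℕ → ℤ) → ℕ → ℕ → Set
TriangleEmbedded R r c =
  Σ (ℕ → ℕ) λ l →
    (∀ t → 1 ≤ t → t ≤ r → LastNonzero R c t (l t)) ×
    (∀ t → 1 ≤ t → t < r → l t < l (suc t))

-- Multiplying p_k by X - 1 kills all coefficients strictly between q and k, because those of
-- p_k are -1 from degree q to k - 1. Hence G satisfies a recursion involving only
-- G_n, …, G_{n+q} and G_{n+k+1}; as k = c + q - 1, this expresses each entry of the rectangle
-- through the q + 1 entries of the row above ending in the same column (the triangle
-- recursion). The first row comes from the initial values, so by induction every row agrees
-- with a triangle independent of r: row t + 1 is row t shifted q columns to the right and
-- recombined, its last nonzero entry -(last entry of row t) sits at 2 + tq, and its first
-- entry is (1 - a_q)^t ≠ 0. The shift works because each row ends in at least q zeros.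

module Submission where

open import Defs
open import Data.Nat as ℕ using (ℕ; zero; suc; _∸_; _≤_; _<_; z≤n; s≤s)
import Data.Nat.Properties as ℕₚ
import Data.Nat.Tactic.RingSolver as ℕ-Solver
open import Data.Integer as ℤ using (ℤ; +_; _+_; _-_; _*_; -_; ∣_∣)
import Data.Integer.Properties as ℤₚ
open import Data.Integer.Tactic.RingSolver using (solve-∀)
open import Data.List using (List; []; _∷_; _++_; [_]; replicate; length)
import Data.List.Properties as Listₚ
open import Data.Bool using (true)
open import Data.Empty using (⊥-elim)
open import Data.Product using (_×_; _,_; proj₁)
open import Data.Sum using (inj₁; inj₂)
open import Relation.Nullary using (yes; no)
open import Relation.Binary.PropositionalEquality hiding ([_])

private
  <-+-suc : ∀ {i} lo n → i < suc lo ℕ.+ n → i < lo ℕ.+ suc n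
  <-+-suc {i} lo n = subst (i <_) (sym (ℕₚ.+-suc lo n))

  lo<lo+suc : ∀ lo n → lo < lo ℕ.+ suc n
  lo<lo+suc lo n = ℕₚ.m<m+n lo (s≤s z≤n)

sumRange-cong : ∀ lo n {f g : ℕ → ℤ} → (∀ i → lo ≤ i → i < lo ℕ.+ n → f i ≡ g i) →
                sumRange lo n f ≡ sumRange lo n g
sumRange-cong lo zero    f≡g = refl
sumRange-cong lo (suc n) f≡g =
  cong₂ _+_ (f≡g lo ℕₚ.≤-refl (lo<lo+suc lo n))
            (sumRange-cong (suc lo) n λ i lo<i i< → f≡g i (ℕₚ.<⇒≤ lo<i) (<-+-suc lo n i<))

sumRange-zero : ∀ lo n {f : ℕ → ℤ} → (∀ i → lo ≤ i → i < lo ℕ.+ n → f i ≡ + 0) →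
                sumRange lo n f ≡ + 0
sumRange-zero lo zero    f≡0 = refl
sumRange-zero lo (suc n) f≡0 =
  cong₂ _+_ (f≡0 lo ℕₚ.≤-refl (lo<lo+suc lo n))
            (sumRange-zero (suc lo) n λ i lo<i i< → f≡0 i (ℕₚ.<⇒≤ lo<i) (<-+-suc lo n i<))

sumRange-single : ∀ lo n m {f : ℕ → ℤ} → lo ≤ m → m < lo ℕ.+ n →
                  (∀ i → lo ≤ i → i < lo ℕ.+ n → i ≢ m → f i ≡ + 0) → sumRange lo n f ≡ f m
sumRange-single lo zero m lo≤m m<lo _ =
  ⊥-elim (ℕₚ.<-irrefl refl (ℕₚ.≤-<-trans lo≤m (subst (m <_) (ℕₚ.+-identityʳ lo) m<lo)))
sumRange-single lo (suc n) m {f} lo≤m m< f≡0 with lo ℕₚ.≟ m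
... | yes refl =
  trans (cong (λ x → f lo + x) (sumRange-zero (suc lo) n λ i lo<i i< →
          f≡0 i (ℕₚ.<⇒≤ lo<i) (<-+-suc lo n i<) λ { refl → ℕₚ.<-irrefl refl lo<i }))
        (ℤₚ.+-identityʳ (f lo))
... | no lo≢m =
  trans (cong (_+ sumRange (suc lo) n f) (f≡0 lo ℕₚ.≤-refl (lo<lo+suc lo n) lo≢m))
        (trans (ℤₚ.+-identityˡ _) (sumRange-single (suc lo) n m (ℕₚ.≤∧≢⇒< lo≤m lo≢m) (subst (m <_) (ℕₚ.+-suc lo n) m<)
          λ i lo<i i< → f≡0 i (ℕₚ.<⇒≤ lo<i) (<-+-suc lo n i<)))

sumRange-shift : ∀ lo n (f : ℕ → ℤ) → sumRange (suc lo) n f ≡ sumRange lo n (λ i → f (suc i))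
sumRange-shift lo zero    f = refl
sumRange-shift lo (suc n) f = cong (λ x → f (suc lo) + x) (sumRange-shift (suc lo) n f)

sumRange-split : ∀ lo m n (f : ℕ → ℤ) →
                 sumRange lo (m ℕ.+ n) f ≡ sumRange lo m f + sumRange (lo ℕ.+ m) n f
sumRange-split lo zero    n f =
  trans (cong (λ l → sumRange l n f) (sym (ℕₚ.+-identityʳ lo))) (sym (ℤₚ.+-identityˡ _))
sumRange-split lo (suc m) n f = begin
  f lo + sumRange (suc lo) (m ℕ.+ n) f
    ≡⟨ cong (λ x → f lo + x) (sumRange-split (suc lo) m n f) ⟩
  f lo + (sumRange (suc lo) m f + sumRange (suc lo ℕ.+ m) n f)
    ≡⟨ sym (ℤₚ.+-assoc (f lo) _ _) ⟩
  f lo + sumRange (suc lo) m f + sumRange (suc lo ℕ.+ m) n f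
    ≡⟨ cong (λ l → f lo + sumRange (suc lo) m f + sumRange l n f) (sym (ℕₚ.+-suc lo m)) ⟩
  f lo + sumRange (suc lo) m f + sumRange (lo ℕ.+ suc m) n f ∎
  where open ≡-Reasoning

sumRange-snoc : ∀ lo n (f : ℕ → ℤ) → sumRange lo (suc n) f ≡ sumRange lo n f + f (lo ℕ.+ n)
sumRange-snoc lo n f =
  trans (cong (λ m → sumRange lo m f) (ℕₚ.+-comm 1 n))
        (trans (sumRange-split lo n 1 f) (cong (λ x → sumRange lo n f + x) (ℤₚ.+-identityʳ _)))

sumRange-+ : ∀ lo n (f g : ℕ → ℤ) →
             sumRange lo n (λ i → f i + g i) ≡ sumRange lo n f + sumRange lo n g
sumRange-+ lo zero    f g = refl
sumRange-+ lo (suc n) f g =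
  trans (cong (λ x → f lo + g lo + x) (sumRange-+ (suc lo) n f g))
        (interchange (f lo) (g lo) _ _)
  where
  interchange : ∀ a b c d → a + b + (c + d) ≡ a + c + (b + d)
  interchange = solve-∀

sumRange-*ˡ : ∀ lo n x (f : ℕ → ℤ) → sumRange lo n (λ i → x * f i) ≡ x * sumRange lo n f
sumRange-*ˡ lo zero    x f = sym (ℤₚ.*-zeroʳ x)
sumRange-*ˡ lo (suc n) x f =
  trans (cong (λ y → x * f lo + y) (sumRange-*ˡ (suc lo) n x f))
        (sym (ℤₚ.*-distribˡ-+ x (f lo) _))

nth : List ℤ → ℕ → ℤ
nth []       _       = + 0
nth (x ∷ xs) zero    = x
nth (x ∷ xs) (suc i) = nth xs i

nth-++-< : ∀ xs ys i → i < length xs → nth (xs ++ ys) i ≡ nth xs i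
nth-++-< (x ∷ xs) ys zero    _         = refl
nth-++-< (x ∷ xs) ys (suc i) (s≤s i<n) = nth-++-< xs ys i i<n

nth-++-length : ∀ xs y → nth (xs ++ [ y ]) (length xs) ≡ y
nth-++-length []       y = refl
nth-++-length (x ∷ xs) y = nth-++-length xs y

nth-replicate-0 : ∀ n i → nth (replicate n (+ 0)) i ≡ + 0
nth-replicate-0 zero    i       = refl
nth-replicate-0 (suc n) zero    = refl
nth-replicate-0 (suc n) (suc i) = nth-replicate-0 n i

headOr0≡nth-0 : ∀ w → headOr0 w ≡ nth w 0
headOr0≡nth-0 []      = refl
headOr0≡nth-0 (x ∷ w) = refl

dot≡sumRange : ∀ c j w → dot c j w ≡ sumRange 0 (length w) (λ e → c (j ℕ.+ e) * nth w e)
dot≡sumRange c j []      = refl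
dot≡sumRange c j (x ∷ w) =
  cong₂ _+_ (cong (λ i → c i * x) (sym (ℕₚ.+-identityʳ j)))
    (trans (dot≡sumRange c (suc j) w)
      (trans (sumRange-cong 0 (length w) λ e _ _ → cong (λ i → c i * nth w e) (sym (ℕₚ.+-suc j e)))
             (sym (sumRange-shift 0 (length w) (λ e → c (j ℕ.+ e) * nth (x ∷ w) e)))))

module LinearRecurrence (c : ℕ → ℤ) (K : ℕ) where

  private
    G : ℕ → ℤ
    G = recSeq c (suc K)

    w : ℕ → List ℤ
    w = window c (suc K)

    length-stepWindow : ∀ v → length v ≡ suc K → length (stepWindow c v) ≡ suc K
    length-stepWindow (x ∷ xs) eq = trans (Listₚ.length-++ xs) (trans (ℕₚ.+-comm (length xs) 1) eq)

    length-window : ∀ m → length (w m) ≡ suc K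
    length-window zero    = cong suc (Listₚ.length-replicate K)
    length-window (suc m) = length-stepWindow (w m) (length-window m)

    nth-stepWindow : ∀ v i → length v ≡ suc K → i < K → nth (stepWindow c v) i ≡ nth v (suc i)
    nth-stepWindow (x ∷ xs) i eq i<K =
      nth-++-< xs _ i (subst (i <_) (sym (ℕₚ.suc-injective eq)) i<K)

    nth-stepWindow-last : ∀ v → length v ≡ suc K → nth (stepWindow c v) K ≡ dot c 0 v
    nth-stepWindow-last (x ∷ xs) eq rewrite sym (ℕₚ.suc-injective eq) = nth-++-length xs _

  nth-window : ∀ i m → i < suc K → nth (w m) i ≡ G (suc (m ℕ.+ i))
  nth-window zero    m _ = trans (sym (headOr0≡nth-0 (w m))) (cong G (cong suc (sym (ℕₚ.+-identityʳ m))))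
  nth-window (suc i) m (s≤s i<K) =
    trans (sym (nth-stepWindow (w m) i (length-window m) i<K))
      (trans (nth-window i (suc m) (s≤s (ℕₚ.<⇒≤ i<K)))
             (cong (λ j → G (suc j)) (sym (ℕₚ.+-suc m i))))

  initial-zero : ∀ i → 2 ≤ i → i ≤ suc K → G i ≡ + 0
  initial-zero (suc zero)    (s≤s ())
  initial-zero (suc (suc i)) _ i≤K = trans (sym (nth-window (suc i) 0 i≤K)) (nth-replicate-0 K i)

  recurrence : ∀ n → 1 ≤ n → G (n ℕ.+ suc K) ≡ sumRange 0 (suc K) (λ e → c e * G (n ℕ.+ e))
  recurrence (suc m) _ = begin
    G (suc m ℕ.+ suc K)               ≡⟨ cong (λ j → G (suc j)) (ℕₚ.+-suc m K) ⟩
    G (suc (suc m ℕ.+ K))             ≡⟨ sym (nth-window K (suc m) ℕₚ.≤-refl) ⟩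
    nth (stepWindow c (w m)) K        ≡⟨ nth-stepWindow-last (w m) (length-window m) ⟩
    dot c 0 (w m)                     ≡⟨ dot≡sumRange c 0 (w m) ⟩
    sumRange 0 (length (w m)) (λ e → c e * nth (w m) e)
      ≡⟨ cong (λ l → sumRange 0 l (λ e → c e * nth (w m) e)) (length-window m) ⟩
    sumRange 0 (suc K) (λ e → c e * nth (w m) e)
      ≡⟨ sumRange-cong 0 (suc K) (λ e _ e<k → cong (c e *_) (nth-window e m e<k)) ⟩
    sumRange 0 (suc K) (λ e → c e * G (suc m ℕ.+ e)) ∎
    where open ≡-Reasoning

-- Substituting the recursion at n for the top term G (n + k) of the recursion at n + 1.
recurrence-shift : ∀ (c : ℕ → ℤ) K (G : ℕ → ℤ) →
  (∀ n → 1 ≤ n → G (n ℕ.+ suc K) ≡ sumRange 0 (suc K) (λ e → c e * G (n ℕ.+ e))) →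
  ∀ n → 1 ≤ n →
  G (suc n ℕ.+ suc K) ≡ c K * c 0 * G n + sumRange 1 K (λ e → (c (e ∸ 1) + c K * c e) * G (n ℕ.+ e))
recurrence-shift c K G rec n 1≤n = begin
  G (suc n ℕ.+ suc K)
    ≡⟨ rec (suc n) (s≤s z≤n) ⟩
  sumRange 0 (suc K) (λ e → c e * G (suc n ℕ.+ e))
    ≡⟨ sumRange-snoc 0 K _ ⟩
  sumRange 0 K (λ e → c e * G (suc n ℕ.+ e)) + c K * G (suc n ℕ.+ K)
    ≡⟨ cong₂ _+_ lower-terms (cong (λ i → c K * G i) (sym (ℕₚ.+-suc n K))) ⟩
  A + c K * G (n ℕ.+ suc K)
    ≡⟨ cong (λ x → A + c K * x) (rec n 1≤n) ⟩
  A + c K * (c 0 * G (n ℕ.+ 0) + B)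
    ≡⟨ cong (λ i → A + c K * (c 0 * G i + B)) (ℕₚ.+-identityʳ n) ⟩
  A + c K * (c 0 * G n + B)
    ≡⟨ regroup A (c K) (c 0 * G n) B ⟩
  c K * (c 0 * G n) + (A + c K * B)
    ≡⟨ cong₂ _+_ (sym (ℤₚ.*-assoc (c K) (c 0) (G n))) (sym combine) ⟩
  c K * c 0 * G n + sumRange 1 K (λ e → (c (e ∸ 1) + c K * c e) * G (n ℕ.+ e)) ∎
  where
  open ≡-Reasoning
  A B : ℤ
  A = sumRange 1 K (λ e → c (e ∸ 1) * G (n ℕ.+ e))
  B = sumRange 1 K (λ e → c e * G (n ℕ.+ e))

  lower-terms : sumRange 0 K (λ e → c e * G (suc n ℕ.+ e)) ≡ A
  lower-terms = sym (trans (sumRange-shift 0 K _)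
    (sumRange-cong 0 K λ e _ _ → cong (λ i → c e * G i) (ℕₚ.+-suc n e)))

  regroup : ∀ a x y b → a + x * (y + b) ≡ x * y + (a + x * b)
  regroup = solve-∀

  distribute : ∀ u x v g → (u + x * v) * g ≡ u * g + x * (v * g)
  distribute = solve-∀

  combine : sumRange 1 K (λ e → (c (e ∸ 1) + c K * c e) * G (n ℕ.+ e)) ≡ A + c K * B
  combine = begin
    sumRange 1 K (λ e → (c (e ∸ 1) + c K * c e) * G (n ℕ.+ e))
      ≡⟨ sumRange-cong 1 K (λ e _ _ → distribute (c (e ∸ 1)) (c K) (c e) (G (n ℕ.+ e))) ⟩
    sumRange 1 K (λ e → c (e ∸ 1) * G (n ℕ.+ e) + c K * (c e * G (n ℕ.+ e)))
      ≡⟨ sumRange-+ 1 K _ _ ⟩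
    A + sumRange 1 K (λ e → c K * (c e * G (n ℕ.+ e)))
      ≡⟨ cong (λ x → A + x) (sumRange-*ˡ 1 K (c K) _) ⟩
    A + c K * B ∎

monomial-diag : ∀ m → monomial m m ≡ + 1
monomial-diag zero    = refl
monomial-diag (suc m) = monomial-diag m

monomial-off : ∀ m j → m ≢ j → monomial m j ≡ + 0
monomial-off zero    zero    m≢j = ⊥-elim (m≢j refl)
monomial-off zero    (suc j) _   = refl
monomial-off (suc m) zero    _   = refl
monomial-off (suc m) (suc j) m≢j = monomial-off m j (λ m≡j → m≢j (cong suc m≡j))

taylorCoeffs-≤ : ∀ s k e → e ≤ k → taylorCoeffs s k e ≡ s e
taylorCoeffs-≤ s k e e≤k with e ℕ.≤ᵇ k | ℕₚ.≤⇒≤ᵇ e≤k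
... | true | _ = refl

module _ (q₁ : ℕ) (a : ℕ → ℤ) where

  private
    monomialTerms : ℕ → ℤ
    monomialTerms j = sumRange 2 q₁ (λ i → (a i - + 1) * monomial (i ∸ 1) j)

    monomialTerms-outside : ∀ j → (∀ i → 2 ≤ i → i ≤ suc q₁ → i ∸ 1 ≢ j) → monomialTerms j ≡ + 0
    monomialTerms-outside j i≢ = sumRange-zero 2 q₁ λ i 2≤i i<q →
      trans (cong ((a i - + 1) *_) (monomial-off (i ∸ 1) j (i≢ i 2≤i (ℕₚ.≤-pred i<q))))
            (ℤₚ.*-zeroʳ (a i - + 1))

  Tseries-0 : Tseries (suc q₁) a 0 ≡ + 1
  Tseries-0 = cong (λ x → + 1 - x) (monomialTerms-outside 0 λ { (suc zero) (s≤s ()) ; (suc (suc i)) _ _ () })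

  Tseries-low : ∀ j → 1 ≤ j → j ≤ q₁ → Tseries (suc q₁) a j ≡ - a (suc j)
  Tseries-low (suc j) _ j≤q₁ = begin
    - + 1 - monomialTerms (suc j)
      ≡⟨ cong (λ x → - + 1 - x) (sumRange-single 2 q₁ (suc (suc j)) (s≤s (s≤s z≤n)) (s≤s (s≤s j≤q₁)) off) ⟩
    - + 1 - (a (suc (suc j)) - + 1) * monomial (suc j) (suc j)
      ≡⟨ cong (λ x → - + 1 - (a (suc (suc j)) - + 1) * x) (monomial-diag (suc j)) ⟩
    - + 1 - (a (suc (suc j)) - + 1) * + 1
      ≡⟨ simplify (a (suc (suc j))) ⟩
    - a (suc (suc j)) ∎
    where
    open ≡-Reasoning
    simplify : ∀ x → - + 1 - (x - + 1) * + 1 ≡ - x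
    simplify = solve-∀
    off : ∀ i → 2 ≤ i → i < 2 ℕ.+ q₁ → i ≢ suc (suc j) → (a i - + 1) * monomial (i ∸ 1) (suc j) ≡ + 0
    off (suc i) _ _ i≢ = trans (cong ((a (suc i) - + 1) *_) (monomial-off i (suc j) (λ { refl → i≢ refl })))
                               (ℤₚ.*-zeroʳ (a (suc i) - + 1))

  Tseries-high : ∀ j → suc q₁ ≤ j → Tseries (suc q₁) a j ≡ - + 1
  Tseries-high (suc j) (s≤s q₁≤j) = cong (λ x → - + 1 - x) (monomialTerms-outside (suc j) λ
    { (suc i) _ i≤q refl → ℕₚ.<-irrefl refl (ℕₚ.≤-trans (ℕₚ.≤-pred i≤q) q₁≤j) })

module Triangle (q₂ : ℕ) (a : ℕ → ℤ) where

  q₁ q : ℕ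
  q₁ = suc q₂
  q  = suc q₁

  triangleCombination : ℤ → (ℕ → ℤ) → ℤ → ℤ → ℤ
  triangleCombination x f y z =
    - (a q - + 1) * x - sumRange 2 q₂ (λ e → (a e - a (suc e)) * f e) + (+ 1 + a 2) * y - z

  triangleStep : (ℕ → ℤ) → ℤ
  triangleStep V = triangleCombination (V q) V (V 1) (V 0)

  triangleCombination-cong : ∀ {x x′ f f′ y y′ z z′} → x ≡ x′ →
    (∀ e → 2 ≤ e → e < q → f e ≡ f′ e) → y ≡ y′ → z ≡ z′ →
    triangleCombination x f y z ≡ triangleCombination x′ f′ y′ z′
  triangleCombination-cong {f = f} {f′} refl f≡f′ refl refl =
    cong (λ S → - (a q - + 1) * _ - S + (+ 1 + a 2) * _ - _)
         (sumRange-cong 2 q₂ λ e 2≤e e<q → cong ((a e - a (suc e)) *_) (f≡f′ e 2≤e e<q))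

  triangleStep-cong : ∀ {V V′} → (∀ e → e ≤ q → V e ≡ V′ e) → triangleStep V ≡ triangleStep V′
  triangleStep-cong V≡V′ = triangleCombination-cong (V≡V′ q ℕₚ.≤-refl)
    (λ e _ e<q → V≡V′ e (ℕₚ.<⇒≤ e<q)) (V≡V′ 1 (s≤s z≤n)) (V≡V′ 0 z≤n)

  triangleStep-bottom : ∀ V → (∀ e → 1 ≤ e → e ≤ q → V e ≡ + 0) → triangleStep V ≡ - V 0
  triangleStep-bottom V V≡0 = trans
    (triangleCombination-cong {f′ = λ _ → + 0} (V≡0 q (s≤s z≤n) ℕₚ.≤-refl)
      (λ e 2≤e e<q → V≡0 e (ℕₚ.<⇒≤ 2≤e) (ℕₚ.<⇒≤ e<q)) (V≡0 1 ℕₚ.≤-refl (s≤s z≤n)) refl)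
    (trans (cong (λ S → - (a q - + 1) * + 0 - S + (+ 1 + a 2) * + 0 - V 0)
                 (sumRange-zero 2 q₂ λ e _ _ → ℤₚ.*-zeroʳ (a e - a (suc e))))
           (simplify (a q - + 1) (+ 1 + a 2) (V 0)))
    where
    simplify : ∀ x y v → - x * + 0 - + 0 + y * + 0 - v ≡ - v
    simplify = solve-∀

  triangleStep-zero : ∀ V → (∀ e → e ≤ q → V e ≡ + 0) → triangleStep V ≡ + 0
  triangleStep-zero V V≡0 =
    trans (triangleStep-bottom V λ e _ e≤q → V≡0 e e≤q) (cong -_ (V≡0 0 z≤n))

  triangleStep-top : ∀ V → (∀ e → e < q → V e ≡ + 0) → triangleStep V ≡ - (a q - + 1) * V q
  triangleStep-top V V≡0 = trans
    (triangleCombination-cong {f′ = λ _ → + 0} refl (λ e _ e<q → V≡0 e e<q)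
      (V≡0 1 (s≤s (s≤s z≤n))) (V≡0 0 (s≤s z≤n)))
    (trans (cong (λ S → - (a q - + 1) * V q - S + (+ 1 + a 2) * + 0 - + 0)
                 (sumRange-zero 2 q₂ λ e _ _ → ℤₚ.*-zeroʳ (a e - a (suc e))))
           (simplify (a q - + 1) (+ 1 + a 2) (V q)))
    where
    simplify : ∀ x y v → - x * v - + 0 + y * + 0 - + 0 ≡ - x * v
    simplify = solve-∀

  module _ (m : ℕ) where

    private
      K : ℕ
      K = q ℕ.+ m

      c : ℕ → ℤ
      c = taylorCoeffs (Tseries q a) (suc K)

      c-0 : c 0 ≡ + 1
      c-0 = trans (taylorCoeffs-≤ (Tseries q a) (suc K) 0 z≤n) (Tseries-0 q₁ a)

      c-low : ∀ e → 1 ≤ e → e ≤ q₁ → c e ≡ - a (suc e)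
      c-low e 1≤e e≤q₁ =
        trans (taylorCoeffs-≤ (Tseries q a) (suc K) e (ℕₚ.≤-trans e≤q₁ (ℕₚ.m≤n⇒m≤1+n (ℕₚ.≤-trans (ℕₚ.n≤1+n q₁) (ℕₚ.m≤m+n q m)))))
              (Tseries-low q₁ a e 1≤e e≤q₁)

      c-high : ∀ e → q ≤ e → e ≤ suc K → c e ≡ - + 1
      c-high e q≤e e≤k = trans (taylorCoeffs-≤ (Tseries q a) (suc K) e e≤k) (Tseries-high q₁ a e q≤e)

      c-K : c K ≡ - + 1
      c-K = c-high K (ℕₚ.m≤m+n q m) (ℕₚ.n≤1+n K)

      -- Since c_{k-1} = -1, these are the coefficients c_{e-1} - c_e of (X - 1) p_k(X).
      d : ℕ → ℤ
      d e = c (e ∸ 1) + c K * c e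

      d-1 : d 1 ≡ + 1 + a 2
      d-1 = trans (cong₂ (λ x y → x + c K * y) c-0 (c-low 1 ℕₚ.≤-refl (s≤s z≤n)))
                  (trans (cong (λ x → + 1 + x * - a 2) c-K) (simplify (a 2)))
        where
        simplify : ∀ b → + 1 + - + 1 * - b ≡ + 1 + b
        simplify = solve-∀

      d-middle : ∀ e → 2 ≤ e → e < q → d e ≡ - (a e - a (suc e))
      d-middle (suc e) (s≤s 1≤e) (s≤s e<q₁) =
        trans (cong₂ (λ x y → x + c K * y) (c-low e 1≤e (ℕₚ.<⇒≤ e<q₁)) (c-low (suc e) (s≤s z≤n) e<q₁))
              (trans (cong (λ x → - a (suc e) + x * - a (suc (suc e))) c-K)
                     (simplify (a (suc e)) (a (suc (suc e)))))
        where
        simplify : ∀ b b′ → - b + - + 1 * - b′ ≡ - (b - b′)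
        simplify = solve-∀

      d-q : d q ≡ - (a q - + 1)
      d-q = trans (cong₂ (λ x y → x + c K * y) (c-low q₁ (s≤s z≤n) ℕₚ.≤-refl)
                         (c-high q ℕₚ.≤-refl (ℕₚ.m≤n⇒m≤1+n (ℕₚ.m≤m+n q m))))
                  (trans (cong (λ x → - a q + x * - + 1) c-K) (simplify (a q)))
        where
        simplify : ∀ b → - b + - + 1 * - + 1 ≡ - (b - + 1)
        simplify = solve-∀

      d-high : ∀ e → q < e → e ≤ K → d e ≡ + 0
      d-high (suc e) (s≤s q≤e) e≤K =
        trans (cong₂ (λ x y → x + c K * y) (c-high e q≤e (ℕₚ.≤-trans (ℕₚ.n≤1+n e) (ℕₚ.m≤n⇒m≤1+n e≤K)))
                                           (c-high (suc e) (ℕₚ.≤-trans q≤e (ℕₚ.n≤1+n e)) (ℕₚ.m≤n⇒m≤1+n e≤K)))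
              (cong (λ x → - + 1 + x * - + 1) c-K)

    differenced-sum : ∀ (V : ℕ → ℤ) → sumRange 1 K (λ e → d e * V e) ≡
      (+ 1 + a 2) * V 1 - sumRange 2 q₂ (λ e → (a e - a (suc e)) * V e) - (a q - + 1) * V q
    differenced-sum V = begin
      h 1 + sumRange 2 (suc (q₂ ℕ.+ m)) h
        ≡⟨ cong (λ n → h 1 + sumRange 2 n h) (sym (ℕₚ.+-suc q₂ m)) ⟩
      h 1 + sumRange 2 (q₂ ℕ.+ suc m) h
        ≡⟨ cong (λ x → h 1 + x) (sumRange-split 2 q₂ (suc m) h) ⟩
      h 1 + (sumRange 2 q₂ h + (h q + sumRange (suc q) m h))
        ≡⟨ cong₂ (λ x y → x * V 1 + (sumRange 2 q₂ h + (y * V q + sumRange (suc q) m h))) d-1 d-q ⟩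
      (+ 1 + a 2) * V 1 + (sumRange 2 q₂ h + (- (a q - + 1) * V q + sumRange (suc q) m h))
        ≡⟨ cong₂ (λ x y → (+ 1 + a 2) * V 1 + (x + (- (a q - + 1) * V q + y))) middle above-q ⟩
      (+ 1 + a 2) * V 1 + (- + 1 * S + (- (a q - + 1) * V q + + 0))
        ≡⟨ regroup (a 2) (a q) (V 1) (V q) S ⟩
      (+ 1 + a 2) * V 1 - S - (a q - + 1) * V q ∎
      where
      open ≡-Reasoning
      h : ℕ → ℤ
      h e = d e * V e
      S : ℤ
      S = sumRange 2 q₂ (λ e → (a e - a (suc e)) * V e)

      regroup : ∀ b₂ b v₁ v S → (+ 1 + b₂) * v₁ + (- + 1 * S + (- (b - + 1) * v + + 0)) ≡
                                (+ 1 + b₂) * v₁ - S - (b - + 1) * v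
      regroup = solve-∀

      neg-assoc : ∀ x y → - x * y ≡ - + 1 * (x * y)
      neg-assoc = solve-∀

      middle : sumRange 2 q₂ h ≡ - + 1 * S
      middle = trans (sumRange-cong 2 q₂ λ e 2≤e e<q →
                        trans (cong (_* V e) (d-middle e 2≤e e<q)) (neg-assoc (a e - a (suc e)) (V e)))
                     (sumRange-*ˡ 2 q₂ (- + 1) _)

      above-q : sumRange (suc q) m h ≡ + 0
      above-q = sumRange-zero (suc q) m λ e q<e e<K →
        trans (cong (_* V e) (d-high e q<e (ℕₚ.≤-pred e<K))) (ℤₚ.*-zeroˡ (V e))

    recurrence⇒triangleStep : ∀ (G : ℕ → ℤ) →
      (∀ n → 1 ≤ n → G (n ℕ.+ suc K) ≡ sumRange 0 (suc K) (λ e → c e * G (n ℕ.+ e))) →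
      ∀ n → 1 ≤ n → G (suc n ℕ.+ suc K) ≡ triangleStep (λ e → G (n ℕ.+ e))
    recurrence⇒triangleStep G rec n 1≤n = begin
      G (suc n ℕ.+ suc K)
        ≡⟨ recurrence-shift c K G rec n 1≤n ⟩
      c K * c 0 * G n + sumRange 1 K (λ e → d e * V e)
        ≡⟨ cong₂ (λ x y → x * y * G n + sumRange 1 K (λ e → d e * V e)) c-K c-0 ⟩
      - + 1 * + 1 * G n + sumRange 1 K (λ e → d e * V e)
        ≡⟨ cong (λ x → - + 1 * + 1 * G n + x) (differenced-sum V) ⟩
      - + 1 * + 1 * G n + ((+ 1 + a 2) * V 1 - S - (a q - + 1) * V q)
        ≡⟨ regroup (a 2) (a q) (G n) (V 1) (V q) S ⟩
      triangleCombination (V q) V (V 1) (G n)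
        ≡⟨ cong (triangleCombination (V q) V (V 1)) (cong G (sym (ℕₚ.+-identityʳ n))) ⟩
      triangleStep V ∎
      where
      open ≡-Reasoning
      V : ℕ → ℤ
      V e = G (n ℕ.+ e)
      S : ℤ
      S = sumRange 2 q₂ (λ e → (a e - a (suc e)) * V e)
      regroup : ∀ b₂ b g v₁ v S → - + 1 * + 1 * g + ((+ 1 + b₂) * v₁ - S - (b - + 1) * v) ≡
                                   - (b - + 1) * v - S + (+ 1 + b₂) * v₁ - g
      regroup = solve-∀

  -- Rows and columns are numbered from 1 as in the paper; row 0 and column 0 are zero
  -- padding, and truncated subtraction sends every column s + e - q < 1 of the previous row
  -- to column 0.
  triangle : ℕ → ℕ → ℤ
  triangle zero          _                   = + 0
  triangle (suc zero)    zero                = + 0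
  triangle (suc zero)    (suc zero)          = + 1
  triangle (suc zero)    (suc (suc zero))    = - + 1
  triangle (suc zero)    (suc (suc (suc _))) = + 0
  triangle (suc (suc t)) zero                = + 0
  triangle (suc (suc t)) (suc s)             = triangleStep (λ e → triangle (suc t) (s ℕ.+ e ∸ q₁))

  lOf-< : ∀ t → 1 ≤ t → lOf q t < lOf q (suc t)
  lOf-< (suc t) _ = ℕₚ.+-monoʳ-< 2 (ℕₚ.m<n+m (t ℕ.* q) (s≤s z≤n))

  triangle-col0 : ∀ t → triangle t 0 ≡ + 0
  triangle-col0 zero          = refl
  triangle-col0 (suc zero)    = refl
  triangle-col0 (suc (suc t)) = refl

  private
    beyond-next-row : ∀ x s e → 2 ℕ.+ (q ℕ.+ x) < suc s → 2 ℕ.+ x < s ℕ.+ e ∸ q₁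
    beyond-next-row x s e l<s = begin-strict
      2 ℕ.+ x                   <⟨ ℕₚ.n<1+n _ ⟩
      3 ℕ.+ x                   ≡⟨ ℕₚ.m+n∸m≡n q₁ (3 ℕ.+ x) ⟨
      q₁ ℕ.+ (3 ℕ.+ x) ∸ q₁      ≤⟨ ℕₚ.∸-monoˡ-≤ q₁ (subst (_≤ s) (rearrange q₂ x) (ℕₚ.≤-pred l<s)) ⟩
      s ∸ q₁                    ≤⟨ ℕₚ.∸-monoˡ-≤ q₁ (ℕₚ.m≤m+n s e) ⟩
      s ℕ.+ e ∸ q₁              ∎
      where
      open ℕₚ.≤-Reasoning
      rearrange : ∀ q₂ x → 2 ℕ.+ (suc (suc q₂) ℕ.+ x) ≡ suc q₂ ℕ.+ (3 ℕ.+ x)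
      rearrange = ℕ-Solver.solve-∀

    last-column-shift : ∀ x e → suc (q ℕ.+ x) ℕ.+ e ∸ q₁ ≡ 2 ℕ.+ x ℕ.+ e
    last-column-shift x e =
      trans (cong (_∸ q₁) (rearrange q₂ x e)) (ℕₚ.m+n∸m≡n q₁ (2 ℕ.+ x ℕ.+ e))
      where
      rearrange : ∀ q₂ x e → suc (suc (suc q₂) ℕ.+ x) ℕ.+ e ≡ suc q₂ ℕ.+ (2 ℕ.+ x ℕ.+ e)
      rearrange = ℕ-Solver.solve-∀

  triangle-beyond : ∀ t s → lOf q t < s → triangle t s ≡ + 0
  triangle-beyond zero          s                   _   = refl
  triangle-beyond (suc zero)    (suc (suc (suc s))) _   = refl
  triangle-beyond (suc zero)    (suc (suc zero))    (s≤s (s≤s ()))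
  triangle-beyond (suc zero)    (suc zero)          (s≤s ())
  triangle-beyond (suc (suc t)) (suc s)             l<s = triangleStep-zero _ λ e _ →
    triangle-beyond (suc t) (s ℕ.+ e ∸ q₁) (beyond-next-row (t ℕ.* q) s e l<s)

  triangle-last-step : ∀ t → triangle (suc (suc t)) (lOf q (suc (suc t))) ≡ - triangle (suc t) (lOf q (suc t))
  triangle-last-step t = begin
    triangleStep (λ e → triangle (suc t) (suc (q ℕ.+ t ℕ.* q) ℕ.+ e ∸ q₁))
      ≡⟨ triangleStep-cong (λ e _ → cong (triangle (suc t)) (last-column-shift (t ℕ.* q) e)) ⟩
    triangleStep (λ e → triangle (suc t) (l ℕ.+ e))
      ≡⟨ triangleStep-bottom _ (λ e 1≤e _ → triangle-beyond (suc t) (l ℕ.+ e) (ℕₚ.m<m+n l 1≤e)) ⟩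
    - triangle (suc t) (l ℕ.+ 0)
      ≡⟨ cong (λ s → - triangle (suc t) s) (ℕₚ.+-identityʳ l) ⟩
    - triangle (suc t) l ∎
    where
    open ≡-Reasoning
    l : ℕ
    l = lOf q (suc t)

  triangle-first-step : ∀ t → triangle (suc (suc t)) 1 ≡ - (a q - + 1) * triangle (suc t) 1
  triangle-first-step t =
    trans (triangleStep-top _ λ e e<q → trans (cong (triangle (suc t)) (ℕₚ.m≤n⇒m∸n≡0 (ℕₚ.≤-pred e<q)))
                                              (triangle-col0 (suc t)))
          (cong (λ s → - (a q - + 1) * triangle (suc t) s) (ℕₚ.m+n∸n≡m 1 q₁))

  triangle-last≢0 : ∀ t → triangle (suc t) (lOf q (suc t)) ≢ + 0
  triangle-last≢0 zero    = λ ()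
  triangle-last≢0 (suc t) eq = triangle-last≢0 t (ℤₚ.neg-injective (trans (sym (triangle-last-step t)) eq))

  triangle-first≢0 : + 2 ℤ.≤ a q → ∀ t → triangle (suc t) 1 ≢ + 0
  triangle-first≢0 2≤a zero    = λ ()
  triangle-first≢0 2≤a (suc t) eq with ℤₚ.i*j≡0⇒i≡0∨j≡0 _ (trans (sym (triangle-first-step t)) eq)
  ... | inj₂ first≡0 = triangle-first≢0 2≤a t first≡0
  ... | inj₁ factor≡0 with subst (+ 2 ℤ.≤_) (ℤₚ.i-j≡0⇒i≡j (a q) (+ 1) (ℤₚ.neg-injective factor≡0)) 2≤a
  ...   | ℤ.+≤+ (s≤s ())

Rn-index : ∀ k c t s → ∣ + k + (+ suc t - + 1) * + c + + s ∣ ≡ k ℕ.+ t ℕ.* c ℕ.+ s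
Rn-index k c t s = cong ∣_∣ (begin
  + k + (+ suc t - + 1) * + c + + s  ≡⟨ cong (λ x → + k + x * + c + + s) (pred-suc (+ t)) ⟩
  + k + + t * + c + + s              ≡⟨ cong (λ x → + k + x + + s) (ℤₚ.pos-* t c) ⟨
  + (k ℕ.+ t ℕ.* c) + + s            ≡⟨ cong (_+ + s) (ℤₚ.pos-+ k (t ℕ.* c)) ⟨
  + (k ℕ.+ t ℕ.* c ℕ.+ s)            ∎)
  where
  open ≡-Reasoning
  pred-suc : ∀ x → + 1 + x - + 1 ≡ x
  pred-suc = solve-∀

lOf≤cOf : ∀ q t r → t ≤ r → lOf q t ≤ cOf q r
lOf≤cOf q t r t≤r = ℕₚ.+-monoʳ-≤ 2 (ℕₚ.*-monoˡ-≤ q (ℕₚ.∸-monoˡ-≤ 1 t≤r))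


module Member (q₂ : ℕ) (a : ℕ → ℤ) (r′ : ℕ) where

  open Triangle q₂ a

  r k c : ℕ
  r = suc r′
  k = kOf q r
  c = cOf q r

  coeffs : ℕ → ℤ
  coeffs = taylorCoeffs (Tseries q a) k

  G : ℕ → ℤ
  G = Gseq q a r

  open LinearRecurrence coeffs (q ℕ.+ r′ ℕ.* q)

  G-triangle : ∀ n → 1 ≤ n → G (suc n ℕ.+ k) ≡ triangleStep (λ e → G (n ℕ.+ e))
  G-triangle = recurrence⇒triangleStep (r′ ℕ.* q) G recurrence

  k≡q₁+c : k ≡ q₁ ℕ.+ c
  k≡q₁+c = rearrange q₂ (r′ ℕ.* q)
    where
    rearrange : ∀ q₂ x → suc (suc (suc q₂) ℕ.+ x) ≡ suc q₂ ℕ.+ (2 ℕ.+ x)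
    rearrange = ℕ-Solver.solve-∀

  row-index : ∀ x s → k ℕ.+ x ℕ.+ suc s ≡ suc (x ℕ.+ s) ℕ.+ k
  row-index = rearrange k
    where
    rearrange : ∀ k x s → k ℕ.+ x ℕ.+ suc s ≡ suc (x ℕ.+ s) ℕ.+ k
    rearrange = ℕ-Solver.solve-∀

  k+x+y≡c+x+z : ∀ x y z → y ℕ.+ q₁ ≡ z → k ℕ.+ x ℕ.+ y ≡ c ℕ.+ x ℕ.+ z
  k+x+y≡c+x+z x y .(y ℕ.+ q₁) refl = trans (cong (λ m → m ℕ.+ x ℕ.+ y) k≡q₁+c) (rearrange q₁ c x y)
    where
    rearrange : ∀ q₁ c x y → q₁ ℕ.+ c ℕ.+ x ℕ.+ y ≡ c ℕ.+ x ℕ.+ (y ℕ.+ q₁)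
    rearrange = ℕ-Solver.solve-∀

  -- t is 0-based here: RowAgrees t compares row t + 1 of the rectangle with the triangle, and
  -- TailZero t says that G vanishes at the q indices just before that row.
  RowAgrees : ℕ → Set
  RowAgrees t = ∀ s → 1 ≤ s → s ≤ c → G (k ℕ.+ t ℕ.* c ℕ.+ s) ≡ triangle (suc t) s

  TailZero : ℕ → Set
  TailZero t = ∀ u → u ≤ q₁ → G (suc t ℕ.* c ℕ.+ u) ≡ + 0

  coeffs-0 : coeffs 0 ≡ + 1
  coeffs-0 = trans (taylorCoeffs-≤ (Tseries q a) k 0 z≤n) (Tseries-0 q₁ a)

  row-first : RowAgrees 0
  row-first (suc s) _ s<c = trans (cong G (row-index 0 s)) (entry s s<c)
    where
    entry : ∀ s → suc s ≤ c → G (suc s ℕ.+ k) ≡ triangle 1 (suc s)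
    entry zero _ = begin
      G (1 ℕ.+ k)                                             ≡⟨ recurrence 1 ℕₚ.≤-refl ⟩
      coeffs 0 * + 1 + sumRange 1 (q ℕ.+ r′ ℕ.* q) (λ e → coeffs e * G (suc e))
        ≡⟨ cong₂ (λ x y → x * + 1 + y) coeffs-0 (sumRange-zero 1 _ λ e 1≤e e<k →
             trans (cong (coeffs e *_) (initial-zero (suc e) (s≤s 1≤e) e<k)) (ℤₚ.*-zeroʳ (coeffs e))) ⟩
      + 1 ∎
      where open ≡-Reasoning
    entry (suc zero) _ = trans (G-triangle 1 ℕₚ.≤-refl)
      (triangleStep-bottom _ λ e 1≤e e≤q →
        initial-zero (suc e) (s≤s 1≤e) (s≤s (ℕₚ.≤-trans e≤q (ℕₚ.m≤m+n q (r′ ℕ.* q)))))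
    entry (suc (suc s)) (s≤s (s≤s s<R)) = trans (G-triangle (suc (suc s)) (s≤s z≤n))
      (triangleStep-zero _ λ e e≤q → initial-zero (suc (suc s) ℕ.+ e) (s≤s (s≤s z≤n))
        (s≤s (subst (suc s ℕ.+ e ≤_) (ℕₚ.+-comm (r′ ℕ.* q) q) (ℕₚ.+-mono-≤ s<R e≤q))))

  tail-first : TailZero 0
  tail-first u u≤q₁ = initial-zero (c ℕ.+ 0 ℕ.+ u) (ℕₚ.≤-trans (s≤s (s≤s z≤n)) (ℕₚ.m≤m+n _ u)) (begin
    c ℕ.+ 0 ℕ.+ u   ≡⟨ cong (ℕ._+ u) (ℕₚ.+-identityʳ c) ⟩
    c ℕ.+ u         ≤⟨ ℕₚ.+-monoʳ-≤ c u≤q₁ ⟩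
    c ℕ.+ q₁        ≡⟨ ℕₚ.+-comm c q₁ ⟩
    q₁ ℕ.+ c        ≡⟨ k≡q₁+c ⟨
    k               ∎)
    where open ℕₚ.≤-Reasoning

  row-next : ∀ t → RowAgrees t → TailZero t → RowAgrees (suc t)
  row-next t row tail (suc s) _ s<c =
    trans (cong G (row-index (suc t ℕ.* c) s))
      (trans (G-triangle n (s≤s z≤n)) (triangleStep-cong entry))
    where
    n : ℕ
    n = suc t ℕ.* c ℕ.+ s
    entry : ∀ e → e ≤ q → G (n ℕ.+ e) ≡ triangle (suc t) (s ℕ.+ e ∸ q₁)
    entry e e≤q with s ℕ.+ e ℕₚ.≤? q₁
    ... | yes s+e≤q₁ =
      trans (cong G (ℕₚ.+-assoc (suc t ℕ.* c) s e))
        (trans (tail (s ℕ.+ e) s+e≤q₁)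
               (sym (trans (cong (triangle (suc t)) (ℕₚ.m≤n⇒m∸n≡0 s+e≤q₁)) (triangle-col0 (suc t)))))
    ... | no s+e≰q₁ =
      trans (cong G (trans (ℕₚ.+-assoc (suc t ℕ.* c) s e)
                           (sym (k+x+y≡c+x+z (t ℕ.* c) w (s ℕ.+ e) (ℕₚ.m∸n+n≡m (ℕₚ.<⇒≤ q₁<s+e))))))
        (row w (ℕₚ.m<n⇒0<n∸m q₁<s+e) w≤c)
      where
      q₁<s+e : q₁ < s ℕ.+ e
      q₁<s+e = ℕₚ.≰⇒> s+e≰q₁
      w : ℕ
      w = s ℕ.+ e ∸ q₁
      w≤c : w ≤ c
      w≤c = begin
        s ℕ.+ e ∸ q₁       ≤⟨ ℕₚ.∸-monoˡ-≤ q₁ (ℕₚ.+-monoʳ-≤ s e≤q) ⟩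
        s ℕ.+ q ∸ q₁       ≡⟨ cong (_∸ q₁) (ℕₚ.+-suc s q₁) ⟩
        suc s ℕ.+ q₁ ∸ q₁  ≤⟨ ℕₚ.∸-monoˡ-≤ q₁ (ℕₚ.+-monoˡ-≤ q₁ s<c) ⟩
        c ℕ.+ q₁ ∸ q₁      ≡⟨ ℕₚ.m+n∸n≡m c q₁ ⟩
        c                  ∎
        where open ℕₚ.≤-Reasoning

  tail-next : ∀ t → suc t ≤ r′ → RowAgrees t → TailZero (suc t)
  tail-next t t<r′ row u u≤q₁ = begin
    G (c ℕ.+ (c ℕ.+ t ℕ.* c) ℕ.+ u)   ≡⟨ cong G (rearrange c (t ℕ.* c) u) ⟩
    G (c ℕ.+ t ℕ.* c ℕ.+ (c ℕ.+ u))   ≡⟨ cong G (k+x+y≡c+x+z (t ℕ.* c) (d ℕ.+ u) (c ℕ.+ u) d+u+q₁≡c+u) ⟨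
    G (k ℕ.+ t ℕ.* c ℕ.+ (d ℕ.+ u))   ≡⟨ row (d ℕ.+ u) (ℕₚ.≤-trans (s≤s z≤n) l<d+u) d+u≤c ⟩
    triangle (suc t) (d ℕ.+ u)        ≡⟨ triangle-beyond (suc t) (d ℕ.+ u) l<d+u ⟩
    + 0                               ∎
    where
    open ≡-Reasoning
    rearrange : ∀ c x u → c ℕ.+ (c ℕ.+ x) ℕ.+ u ≡ c ℕ.+ x ℕ.+ (c ℕ.+ u)
    rearrange = ℕ-Solver.solve-∀
    d : ℕ
    d = c ∸ q₁
    q₁+l<c : q₁ ℕ.+ suc (lOf q (suc t)) ≤ c
    q₁+l<c = ℕₚ.≤-trans (ℕₚ.≤-reflexive (expand q₂ t)) (ℕₚ.+-monoʳ-≤ 2 (ℕₚ.*-monoˡ-≤ q t<r′))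
      where
      expand : ∀ q₂ t → suc q₂ ℕ.+ suc (2 ℕ.+ t ℕ.* suc (suc q₂)) ≡ 2 ℕ.+ suc t ℕ.* suc (suc q₂)
      expand = ℕ-Solver.solve-∀
    d+q₁≡c : d ℕ.+ q₁ ≡ c
    d+q₁≡c = ℕₚ.m∸n+n≡m (ℕₚ.≤-trans (ℕₚ.m≤m+n q₁ _) q₁+l<c)
    d+u+q₁≡c+u : d ℕ.+ u ℕ.+ q₁ ≡ c ℕ.+ u
    d+u+q₁≡c+u = trans (swap d u q₁) (cong (ℕ._+ u) d+q₁≡c)
      where
      swap : ∀ d u q₁ → d ℕ.+ u ℕ.+ q₁ ≡ d ℕ.+ q₁ ℕ.+ u
      swap = ℕ-Solver.solve-∀
    l<d+u : lOf q (suc t) < d ℕ.+ u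
    l<d+u = ℕₚ.≤-trans (subst (_≤ d) (ℕₚ.m+n∸m≡n q₁ _) (ℕₚ.∸-monoˡ-≤ q₁ q₁+l<c)) (ℕₚ.m≤m+n d u)
    d+u≤c : d ℕ.+ u ≤ c
    d+u≤c = subst (d ℕ.+ u ≤_) d+q₁≡c (ℕₚ.+-monoʳ-≤ d u≤q₁)

  rows : ∀ t → suc t ≤ r → RowAgrees t × TailZero t
  rows zero    _              = row-first , tail-first
  rows (suc t) (s≤s t<r′) with rows t (ℕₚ.m≤n⇒m≤1+n t<r′)
  ... | row , tail = row-next t row tail , tail-next t t<r′ row

  Rn≡triangle : ∀ t → 1 ≤ t → t ≤ r → ∀ s → 1 ≤ s → s ≤ c → Rn q a r t s ≡ triangle t s
  Rn≡triangle (suc t) _ t≤r s 1≤s s≤c = trans (cong G (Rn-index k c t s)) (proj₁ (rows t t≤r) s 1≤s s≤c)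

  Rn≡triangle-upto-last : ∀ t → 1 ≤ t → t ≤ r → ∀ s → 1 ≤ s → s ≤ lOf q t → Rn q a r t s ≡ triangle t s
  Rn≡triangle-upto-last t 1≤t t≤r s 1≤s s≤l = Rn≡triangle t 1≤t t≤r s 1≤s (ℕₚ.≤-trans s≤l (lOf≤cOf q t r t≤r))

  first-row : Rn q a r 1 1 ≡ + 1 × Rn q a r 1 2 ≡ - + 1 × (∀ u → 3 ≤ u → u ≤ c → Rn q a r 1 u ≡ + 0)
  first-row = Rn≡triangle 1 ℕₚ.≤-refl (s≤s z≤n) 1 ℕₚ.≤-refl (s≤s z≤n)
            , Rn≡triangle 1 ℕₚ.≤-refl (s≤s z≤n) 2 (s≤s z≤n) (s≤s (s≤s z≤n))
            , λ u 3≤u u≤c → trans (Rn≡triangle 1 ℕₚ.≤-refl (s≤s z≤n) u (ℕₚ.≤-trans (s≤s z≤n) 3≤u) u≤c)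
                                  (triangle-beyond 1 u 3≤u)

  Rn-recurrence : ∀ i j → 1 ≤ j →
    Rn q a r (suc i) j ≡ sumRange 0 k (λ e → coeffs e * G ((k ℕ.+ i ℕ.* c ℕ.+ j) ∸ k ℕ.+ e))
  Rn-recurrence i j 1≤j = begin
    G ∣ + k + (+ suc i - + 1) * + c + + j ∣   ≡⟨ cong G (trans (Rn-index k c i j) (ℕₚ.+-assoc k (i ℕ.* c) j)) ⟩
    G (k ℕ.+ x)                              ≡⟨ cong G (ℕₚ.+-comm k x) ⟩
    G (x ℕ.+ k)                              ≡⟨ recurrence x (ℕₚ.≤-trans 1≤j (ℕₚ.m≤n+m j (i ℕ.* c))) ⟩
    sumRange 0 k (λ e → coeffs e * G (x ℕ.+ e))
      ≡⟨ sumRange-cong 0 k (λ e _ _ → cong (λ y → coeffs e * G (y ℕ.+ e)) (sym start)) ⟩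
    sumRange 0 k (λ e → coeffs e * G ((k ℕ.+ i ℕ.* c ℕ.+ j) ∸ k ℕ.+ e)) ∎
    where
    open ≡-Reasoning
    x : ℕ
    x = i ℕ.* c ℕ.+ j
    start : (k ℕ.+ i ℕ.* c ℕ.+ j) ∸ k ≡ x
    start = trans (cong (_∸ k) (ℕₚ.+-assoc k (i ℕ.* c) j)) (ℕₚ.m+n∸m≡n k x)

  Rz-previous-row : ∀ i j e J → J ≡ + suc j - + q + + e →
                    Rz q a r (+ suc (suc i) - + 1) J ≡ G (suc i ℕ.* c ℕ.+ j ℕ.+ e)
  Rz-previous-row i j e J refl = cong (λ z → G ∣ z ∣) (begin
    + k + (+ suc (suc i) - + 1 - + 1) * + c + (+ suc j - + q + + e)
      ≡⟨ rearrange (+ q) (+ (r′ ℕ.* q)) (+ i) (+ j) (+ e) ⟩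
    + suc i * + c + + j + + e
      ≡⟨ cong (λ z → z + + j + + e) (ℤₚ.pos-* (suc i) c) ⟨
    + (suc i ℕ.* c) + + j + + e
      ≡⟨ cong (_+ + e) (ℤₚ.pos-+ (suc i ℕ.* c) j) ⟨
    + (suc i ℕ.* c ℕ.+ j) + + e
      ≡⟨ ℤₚ.pos-+ (suc i ℕ.* c ℕ.+ j) e ⟨
    + (suc i ℕ.* c ℕ.+ j ℕ.+ e) ∎)
    where
    open ≡-Reasoning
    rearrange : ∀ Q R I J E → + 1 + (Q + R) + (+ 1 + (+ 1 + I) - + 1 - + 1) * (+ 2 + R) + (+ 1 + J - Q + E)
                              ≡ (+ 1 + I) * (+ 2 + R) + J + E
    rearrange = solve-∀

  Rz-triangle : ∀ i j → 1 ≤ j → Rz q a r (+ suc (suc i)) (+ j) ≡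
    triangleCombination (Rz q a r (+ suc (suc i) - + 1) (+ j))
                        (λ e → Rz q a r (+ suc (suc i) - + 1) (+ j - + q + + e))
                        (Rz q a r (+ suc (suc i) - + 1) (+ j - + q + + 1))
                        (Rz q a r (+ suc (suc i) - + 1) (+ j - + q))
  Rz-triangle i (suc j) _ = begin
    G ∣ + k + (+ suc (suc i) - + 1) * + c + + suc j ∣
      ≡⟨ cong G (trans (Rn-index k c (suc i) (suc j)) (row-index (suc i ℕ.* c) j)) ⟩
    G (suc n ℕ.+ k)
      ≡⟨ G-triangle n (s≤s z≤n) ⟩
    triangleStep (λ e → G (n ℕ.+ e))
      ≡⟨ triangleCombination-cong (sym (Rz-previous-row i j q _ (add-sub (+ suc j) (+ q))))
           (λ e _ _ → sym (Rz-previous-row i j e _ refl)) (sym (Rz-previous-row i j 1 _ refl))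
           (sym (Rz-previous-row i j 0 _ (sym (ℤₚ.+-identityʳ _)))) ⟩
    _ ∎
    where
    open ≡-Reasoning
    n : ℕ
    n = suc i ℕ.* c ℕ.+ j
    add-sub : ∀ x y → x ≡ x - y + y
    add-sub = solve-∀

  entry-recurrences : ∀ i j → 2 ≤ i → i ≤ r → 1 ≤ j → j ≤ c →
    (Rn q a r i j ≡ sumRange 0 k (λ e → coeffs e * G ((k ℕ.+ (i ∸ 1) ℕ.* c ℕ.+ j) ∸ k ℕ.+ e))) ×
    (Rz q a r (+ i) (+ j) ≡
      triangleCombination (Rz q a r (+ i - + 1) (+ j)) (λ e → Rz q a r (+ i - + 1) (+ j - + q + + e))
                          (Rz q a r (+ i - + 1) (+ j - + q + + 1)) (Rz q a r (+ i - + 1) (+ j - + q)))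
  entry-recurrences (suc zero)    _ (s≤s ())
  entry-recurrences (suc (suc i)) j _ _ 1≤j _ = Rn-recurrence (suc i) j 1≤j , Rz-triangle i j 1≤j

  first-column≢0 : + 2 ℤ.≤ a q → ∀ t → 1 ≤ t → t ≤ r → Rn q a r t 1 ≢ + 0
  first-column≢0 2≤a (suc t) _ t≤r eq =
    triangle-first≢0 2≤a t (trans (sym (Rn≡triangle (suc t) (s≤s z≤n) t≤r 1 ℕₚ.≤-refl (s≤s z≤n))) eq)

  last-nonzero : ∀ t → 1 ≤ t → t ≤ r → LastNonzero (Rn q a r) c t (lOf q t)
  last-nonzero (suc t) 1≤t t≤r =
      s≤s z≤n
    , lOf≤cOf q (suc t) r t≤r
    , (λ eq → triangle-last≢0 t (trans (sym (Rn≡triangle (suc t) 1≤t t≤r _ (s≤s z≤n) (lOf≤cOf q (suc t) r t≤r))) eq))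
    , λ u l<u u≤c → trans (Rn≡triangle (suc t) 1≤t t≤r u (ℕₚ.≤-trans (s≤s z≤n) l<u) u≤c)
                          (triangle-beyond (suc t) u l<u)

theorem2p1 :
    (q : ℕ) → 2 ≤ q → (a : ℕ → ℤ) →
    (∀ i → 2 ≤ i → i ≤ q → + 1 ℤ.≤ a i) → + 2 ℤ.≤ a q →
    -- statements (i)–(iv), for each r ≥ 1
    (∀ r → 1 ≤ r →
      -- (i)
      (Rn q a r 1 1 ≡ + 1 × Rn q a r 1 2 ≡ - + 1 ×
        (∀ u → 3 ≤ u → u ≤ cOf q r → Rn q a r 1 u ≡ + 0)) ×
      -- (ii)
      (∀ i j → 2 ≤ i → i ≤ r → 1 ≤ j → j ≤ cOf q r →
        (Rn q a r i j ≡
          sumRange 0 (kOf q r) (λ e →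
            taylorCoeffs (Tseries q a) (kOf q r) e *
            Gseq q a r ((kOf q r ℕ.+ (i ∸ 1) ℕ.* cOf q r ℕ.+ j) ∸ kOf q r ℕ.+ e))) ×
        (Rz q a r (+ i) (+ j) ≡
          - (a q - + 1) * Rz q a r (+ i - + 1) (+ j)
          - sumRange 2 (q ∸ 2) (λ e →
              (a e - a (suc e)) * Rz q a r (+ i - + 1) (+ j - + q + + e))
          + (+ 1 + a 2) * Rz q a r (+ i - + 1) (+ j - + q + + 1)
          - Rz q a r (+ i - + 1) (+ j - + q))) ×
      -- (iii)
      (∀ t → 1 ≤ t → t ≤ r → Rn q a r t 1 ≢ + 0) ×
      -- (iv)
      (∀ t → 1 ≤ t → t ≤ r →
        Rn q a r t (lOf q t) ≢ + 0 ×
        (∀ u → lOf q t < u → u ≤ cOf q r → Rn q a r t u ≡ + 0) ×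
        LastNonzero (Rn q a r) (cOf q r) t (lOf q t))) ×
    -- (v) triangle embedded in every member, l strictly increasing
    (∀ r → 1 ≤ r →
      TriangleEmbedded (Rn q a r) r (cOf q r) ×
      (∀ t → 1 ≤ t → t < r → lOf q t < lOf q (suc t))) ×
    -- (v) compatibility of any two members
    (∀ r₁ r₂ → 1 ≤ r₁ → 1 ≤ r₂ → ∀ t → 1 ≤ t → t ≤ ℕ._⊓_ r₁ r₂ →
      LastNonzero (Rn q a r₁) (cOf q r₁) t (lOf q t) ×
      LastNonzero (Rn q a r₂) (cOf q r₂) t (lOf q t) ×
      (∀ s → 1 ≤ s → s ≤ lOf q t → Rn q a r₁ t s ≡ Rn q a r₂ t s))
theorem2p1 (suc zero)      (s≤s ())
theorem2p1 (suc (suc q₂)) _ a _ 2≤aq =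
    (λ { (suc r′) _ → let open Member q₂ a r′ in
           first-row , entry-recurrences , first-column≢0 2≤aq
         , λ t 1≤t t≤r → let ln@(_ , _ , l≢0 , beyond) = last-nonzero t 1≤t t≤r in l≢0 , beyond , ln })
  , (λ { (suc r′) _ → (lOf q , Member.last-nonzero q₂ a r′ , λ t 1≤t _ → lOf-< t 1≤t)
                    , λ t 1≤t _ → lOf-< t 1≤t })
  , λ { (suc r₁) (suc r₂) _ _ t 1≤t t≤r₁⊓r₂ →
          let t≤r₁ = ℕₚ.m≤n⊓o⇒m≤n (suc r₁) (suc r₂) t≤r₁⊓r₂
              t≤r₂ = ℕₚ.m≤n⊓o⇒m≤o (suc r₁) (suc r₂) t≤r₁⊓r₂ in
          Member.last-nonzero q₂ a r₁ t 1≤t t≤r₁ , Member.last-nonzero q₂ a r₂ t 1≤t t≤r₂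
        , λ s 1≤s s≤l → trans (Member.Rn≡triangle-upto-last q₂ a r₁ t 1≤t t≤r₁ s 1≤s s≤l)
                              (sym (Member.Rn≡triangle-upto-last q₂ a r₂ t 1≤t t≤r₂ s 1≤s s≤l)) }
  where
  open Triangle q₂ a using (q; lOf-<)
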